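{- For every integer $n \geq 1$, \[ \sum_{k \text{ odd}} s(n,k) = \sum_{k \text{ even}} s(n,k) + (-1)^{n}. \]
   Context: A Schröder tree is a plane (ordered) rooted tree in which every internal node (non-leaf) has at least two children; the tree consisting of a single node has one leaf and no internal nodes. For integers $n \geq 1$ and $k \geq 0$, $s(n,k)$ denotes the number of Schröder trees with exactly $n$ leaves and exactly $k$ internal nodes. (Equivalently, $s(n,k)$ is the number of small Schröder paths from $(0,0)$ to $(2n-2,0)$ with exactly $k$ up steps, where a small Schröder path uses steps $U=(1,1)$, $D=(1,-1)$, $F=(2,0)$, never goes below the $x$-axis, and has no $F$ step on the $x$-axis.) -}

module Defs where

open import Data.Nat using (ℕ; zero; suc; _+_; _≤_; _%_)
open import Data.Nat.Base using (_≡ᵇ_)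
open import Data.Bool using (Bool; true; false; if_then_else_)
open import Data.List using (List; []; _∷_; length)
open import Data.Integer as ℤ using (ℤ)
open import Data.Product using (_×_)
open import Data.Sum using (_⊎_)
open import Data.List.Membership.Propositional using (_∈_)
open import Data.List.Relation.Unary.Unique.Propositional using (Unique)
open import Data.List.Relation.Unary.All using (All)
open import Relation.Binary.PropositionalEquality using (_≡_)

data Tree : Set where
  node : List Tree → Tree

mutual
  leaves : Tree → ℕ
  leaves (node []) = 1
  leaves (node (t ∷ ts)) = leavesL (t ∷ ts)

  leavesL : List Tree → ℕ
  leavesL [] = 0
  leavesL (t ∷ ts) = leaves t + leavesL ts

mutual
  internals : Tree → ℕ
  internals (node []) = 0
  internals (node (t ∷ ts)) = suc (internalsL (t ∷ ts))

  internalsL : List Tree → ℕ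
  internalsL [] = 0
  internalsL (t ∷ ts) = internals t + internalsL ts

data IsSchroeder : Tree → Set where
  leaf : IsSchroeder (node [])
  inner : ∀ {ts} → 2 ≤ length ts → All IsSchroeder ts → IsSchroeder (node ts)

IsEnumeration : ℕ → List Tree → Set
IsEnumeration n L =
  Unique L × (∀ t → t ∈ L → IsSchroeder t × leaves t ≡ n)
           × (∀ t → IsSchroeder t → leaves t ≡ n → t ∈ L)

isOdd : ℕ → Bool
isOdd k = k % 2 ≡ᵇ 1

countOdd : List Tree → ℕ
countOdd [] = 0
countOdd (t ∷ ts) = (if isOdd (internals t) then 1 else 0) + countOdd ts

countEven : List Tree → ℕ
countEven [] = 0
countEven (t ∷ ts) = (if isOdd (internals t) then 0 else 1) + countEven ts

signPow : ℕ → ℤ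
signPow zero = ℤ.+ 1
signPow (suc n) = ℤ.- signPow n

-- Weight a Schröder tree by (-1)^(internal nodes), and let t n, f n and p n be
-- the total weights of the trees with n leaves, of the nonempty sequences of
-- trees with n leaves in all, and of those sequences of length at least 2.
-- A tree is a leaf or a root over a sequence of length ≥ 2, and the root flips
-- the sign, so t n = [n = 1] - p n; a sequence is a single tree or has length
-- ≥ 2, so f n = t n + p n = [n = 1].  Splitting off the first tree,
-- p n = Σ_{i+m=n} t i · f m = t (n-1), hence t n = -t (n-1) for n ≥ 2 and
-- t n = (-1)^(n+1), i.e. (#even) - (#odd) = (-1)^(n+1).  The trees are
-- enumerated along this very decomposition, and any two duplicate-free
-- enumerations are permutations of each other, so the weight does not depend
-- on the enumeration.

module Submission where

open import Defs
open import Data.Nat using (ℕ; _≥_)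
open import Data.Integer using (ℤ; +_; _+_)
open import Data.List using (List)
open import Data.Product using (Σ; _×_)
open import Relation.Binary.PropositionalEquality using (_≡_)

open import Data.Nat using (zero; suc; _≤_; z≤n; s≤s; _%_)
import Data.Nat as ℕ
import Data.Nat.Properties as ℕ
open import Data.Nat.DivMod using ([m+n]%n≡m%n)
open import Data.Integer using (0ℤ; 1ℤ; -1ℤ; -_; _-_; _*_)
import Data.Integer.Properties as ℤ
open import Data.Integer.Tactic.RingSolver using (solve-∀)
open import Data.List using ([]; _∷_; _++_; [_]; map; concatMap; cartesianProductWith; length)
open import Data.List.Properties using (∷-injective)
open import Data.List.Relation.Unary.All as All using (All; []; _∷_)
open import Data.List.Relation.Unary.Any using (here; there)
open import Data.List.Relation.Unary.AllPairs using ([]; _∷_)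
open import Data.List.Membership.Propositional using (_∈_; find; lose)
open import Data.List.Membership.Propositional.Properties
  using (∈-map⁺; ∈-map⁻; ∈-++⁺ˡ; ∈-++⁺ʳ; ∈-++⁻; ∈-concatMap⁺; ∈-concatMap⁻;
         ∈-cartesianProductWith⁺; ∈-cartesianProductWith⁻)
open import Data.List.Membership.Propositional.Properties.WithK using (unique∧set⇒bag)
open import Data.List.Relation.Unary.Unique.Propositional using (Unique)
import Data.List.Relation.Unary.Unique.Propositional.Properties as Unique
open import Data.List.Relation.Binary.Permutation.Propositional as ↭ using (_↭_)
open import Data.List.Relation.Binary.BagAndSetEquality using (∼bag⇒↭)
open import Data.Product using (_,_; proj₁; proj₂; map₂; uncurry)
open import Data.Sum using (inj₁; inj₂)
open import Data.Empty using (⊥; ⊥-elim)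
open import Data.Bool using (true; false; if_then_else_)
open import Function using (_∘_)
open import Function.Bundles using (mk⇔)
open import Relation.Binary.PropositionalEquality
  using (_≢_; refl; sym; trans; cong; cong₂; subst; module ≡-Reasoning)

private
  variable
    A B : Set

sumBy : (A → ℤ) → List A → ℤ
sumBy w [] = 0ℤ
sumBy w (x ∷ xs) = w x + sumBy w xs

sumBy-++ : ∀ (w : A → ℤ) xs ys → sumBy w (xs ++ ys) ≡ sumBy w xs + sumBy w ys
sumBy-++ w [] ys = sym (ℤ.+-identityˡ _)
sumBy-++ w (x ∷ xs) ys = trans (cong (_+_ (w x)) (sumBy-++ w xs ys)) (sym (ℤ.+-assoc (w x) _ _))

sumBy-map : ∀ (w : B → ℤ) (f : A → B) xs → sumBy w (map f xs) ≡ sumBy (w ∘ f) xs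
sumBy-map w f [] = refl
sumBy-map w f (x ∷ xs) = cong (_+_ (w (f x))) (sumBy-map w f xs)

sumBy-cong : ∀ {u v : A → ℤ} xs → (∀ {x} → x ∈ xs → u x ≡ v x) → sumBy u xs ≡ sumBy v xs
sumBy-cong [] eq = refl
sumBy-cong (x ∷ xs) eq = cong₂ _+_ (eq (here refl)) (sumBy-cong xs (eq ∘ there))

sumBy-zero : ∀ {w : A → ℤ} xs → (∀ {x} → x ∈ xs → w x ≡ 0ℤ) → sumBy w xs ≡ 0ℤ
sumBy-zero [] _ = refl
sumBy-zero (x ∷ xs) vanishes = cong₂ _+_ (vanishes (here refl)) (sumBy-zero xs (vanishes ∘ there))

sumBy-neg : ∀ (w : A → ℤ) xs → sumBy (-_ ∘ w) xs ≡ - sumBy w xs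
sumBy-neg w [] = refl
sumBy-neg w (x ∷ xs) = trans (cong (_+_ (- w x)) (sumBy-neg w xs)) (sym (ℤ.neg-distrib-+ (w x) _))

sumBy-*ˡ : ∀ c (w : A → ℤ) xs → sumBy ((c *_) ∘ w) xs ≡ c * sumBy w xs
sumBy-*ˡ c w [] = sym (ℤ.*-zeroʳ c)
sumBy-*ˡ c w (x ∷ xs) =
  trans (cong (_+_ (c * w x)) (sumBy-*ˡ c w xs)) (sym (ℤ.*-distribˡ-+ c (w x) _))

sumBy-concatMap : ∀ (w : B → ℤ) (f : A → List B) xs →
  sumBy w (concatMap f xs) ≡ sumBy (sumBy w ∘ f) xs
sumBy-concatMap w f [] = refl
sumBy-concatMap w f (x ∷ xs) =
  trans (sumBy-++ w (f x) (concatMap f xs)) (cong (_+_ (sumBy w (f x))) (sumBy-concatMap w f xs))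

sumBy-cartesianProductWith : ∀ {C : Set} (g : A → B → C) (w : C → ℤ) (u : A → ℤ) (v : B → ℤ) →
  (∀ x y → w (g x y) ≡ u x * v y) →
  ∀ xs ys → sumBy w (cartesianProductWith g xs ys) ≡ sumBy u xs * sumBy v ys
sumBy-cartesianProductWith g w u v split [] ys = refl
sumBy-cartesianProductWith g w u v split (x ∷ xs) ys = begin
  sumBy w (map (g x) ys ++ cartesianProductWith g xs ys)
    ≡⟨ sumBy-++ w (map (g x) ys) _ ⟩
  sumBy w (map (g x) ys) + sumBy w (cartesianProductWith g xs ys)
    ≡⟨ cong₂ _+_ row (sumBy-cartesianProductWith g w u v split xs ys) ⟩
  u x * sumBy v ys + sumBy u xs * sumBy v ys
    ≡⟨ sym (ℤ.*-distribʳ-+ (sumBy v ys) (u x) _) ⟩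
  sumBy u (x ∷ xs) * sumBy v ys ∎
  where
  open ≡-Reasoning
  row : sumBy w (map (g x) ys) ≡ u x * sumBy v ys
  row = trans (sumBy-map w (g x) ys)
          (trans (sumBy-cong ys (λ {y} _ → split x y)) (sumBy-*ˡ (u x) v ys))

sumBy-↭ : ∀ (w : A → ℤ) {xs ys} → xs ↭ ys → sumBy w xs ≡ sumBy w ys
sumBy-↭ w ↭.refl = refl
sumBy-↭ w (↭.prep x p) = cong (_+_ (w x)) (sumBy-↭ w p)
sumBy-↭ w (↭.swap x y p) =
  trans (swap (w x) (w y) _) (cong (λ s → w y + (w x + s)) (sumBy-↭ w p))
  where
  swap : ∀ a b c → a + (b + c) ≡ b + (a + c)
  swap = solve-∀
sumBy-↭ w (↭.trans p q) = trans (sumBy-↭ w p) (sumBy-↭ w q)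

unique-concatMap : (key : B → A) (f : A → List B) →
  (∀ x {y} → y ∈ f x → key y ≡ x) → (∀ x → Unique (f x)) →
  ∀ {xs} → Unique xs → Unique (concatMap f xs)
unique-concatMap key f keyed unique [] = []
unique-concatMap key f keyed unique {x ∷ xs} (x∉xs ∷ xs-unique) =
  Unique.++⁺ (unique x) (unique-concatMap key f keyed unique xs-unique) disjoint
  where
  disjoint : ∀ {y} → y ∈ f x × y ∈ concatMap f xs → ⊥
  disjoint (y∈fx , y∈rest) with find (∈-concatMap⁻ f y∈rest)
  ... | x′ , x′∈xs , y∈fx′ =
    All.lookup x∉xs x′∈xs (trans (sym (keyed x y∈fx)) (keyed x′ y∈fx′))

unique-same-members⇒↭ : ∀ {xs ys : List A} → Unique xs → Unique ys →
  (∀ {z} → z ∈ xs → z ∈ ys) → (∀ {z} → z ∈ ys → z ∈ xs) → xs ↭ ys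
unique-same-members⇒↭ xs-unique ys-unique to from =
  ∼bag⇒↭ (unique∧set⇒bag xs-unique ys-unique (mk⇔ to from))

compositions₂ : ℕ → List (ℕ × ℕ)
compositions₂ zero = []
compositions₂ (suc zero) = []
compositions₂ (suc (suc k)) = (suc k , 1) ∷ map (map₂ suc) (compositions₂ (suc k))

∈-compositions₂⁻ : ∀ {n i m} → (i , m) ∈ compositions₂ n → 1 ≤ i × 1 ≤ m × i ℕ.+ m ≡ n
∈-compositions₂⁻ {suc (suc k)} (here refl) = s≤s z≤n , s≤s z≤n , cong suc (ℕ.+-comm k 1)
∈-compositions₂⁻ {suc (suc k)} (there p) with ∈-map⁻ (map₂ suc) p
... | (i , m) , q , refl with ∈-compositions₂⁻ q
... | 1≤i , _ , i+m≡n = 1≤i , s≤s z≤n , trans (ℕ.+-suc i m) (cong suc i+m≡n)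

∈-compositions₂⁺ : ∀ {i m} → 1 ≤ i → 1 ≤ m → (i , m) ∈ compositions₂ (i ℕ.+ m)
∈-compositions₂⁺ {suc i} {suc zero} _ _ rewrite ℕ.+-comm i 1 = here refl
∈-compositions₂⁺ {suc i} {suc (suc m)} _ _ =
  subst (λ k → (suc i , suc (suc m)) ∈ compositions₂ (suc k)) (sym (ℕ.+-suc i (suc m)))
    (there (∈-map⁺ (map₂ suc) (∈-compositions₂⁺ {suc i} {suc m} (s≤s z≤n) (s≤s z≤n))))

compositions₂-unique : ∀ n → Unique (compositions₂ n)
compositions₂-unique zero = []
compositions₂-unique (suc zero) = []
compositions₂-unique (suc (suc k)) =
  All.tabulate head-fresh ∷ Unique.map⁺ map₂-suc-injective (compositions₂-unique (suc k))
  where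
  map₂-suc-injective : ∀ {p q : ℕ × ℕ} → map₂ suc p ≡ map₂ suc q → p ≡ q
  map₂-suc-injective refl = refl
  head-fresh : ∀ {p} → p ∈ map (map₂ suc) (compositions₂ (suc k)) → (suc k , 1) ≢ p
  head-fresh p∈ refl with ∈-map⁻ (map₂ suc) p∈
  ... | (i , zero) , q , refl with ∈-compositions₂⁻ q
  ... | _ , () , _

leafTrees : ℕ → List Tree
leafTrees 1 = [ node [] ]
leafTrees _ = []

-- The fuel f only drives the recursion: trees f n and forests f n are
-- complete for n ≤ f, forests₂ f n for n ≤ suc f.
mutual
  trees : ℕ → ℕ → List Tree
  trees zero n = []
  trees (suc f) n = leafTrees n ++ map node (forests₂ f n)

  forests : ℕ → ℕ → List (List Tree)
  forests zero n = []
  forests (suc f) n = map [_] (trees (suc f) n) ++ forests₂ f n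

  forests₂ : ℕ → ℕ → List (List Tree)
  forests₂ f n = concatMap (consForests f) (compositions₂ n)

  consForests : ℕ → ℕ × ℕ → List (List Tree)
  consForests f (i , m) = cartesianProductWith _∷_ (trees f i) (forests f m)

IsForest : ℕ → List Tree → Set
IsForest n ts = All IsSchroeder ts × leavesL ts ≡ n

headSplit : List Tree → ℕ × ℕ
headSplit [] = 0 , 0
headSplit (t ∷ ts) = leaves t , leavesL ts

leaves-positive : ∀ t → 1 ≤ leaves t
leaves-positive (node []) = s≤s z≤n
leaves-positive (node (t ∷ ts)) = ℕ.≤-trans (leaves-positive t) (ℕ.m≤m+n (leaves t) (leavesL ts))

leavesL-positive : ∀ ts → 1 ≤ length ts → 1 ≤ leavesL ts
leavesL-positive (t ∷ ts) _ = ℕ.≤-trans (leaves-positive t) (ℕ.m≤m+n (leaves t) (leavesL ts))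

node-isSchroeder : ∀ {n ts} → IsForest n ts → 2 ≤ length ts →
  IsSchroeder (node ts) × leaves (node ts) ≡ n
node-isSchroeder {ts = t ∷ ts} (schroeder , leaves≡n) 2≤len = inner 2≤len schroeder , leaves≡n

mutual
  trees-sound : ∀ f n {t} → t ∈ trees f n → IsSchroeder t × leaves t ≡ n
  trees-sound (suc f) n t∈ with ∈-++⁻ (leafTrees n) t∈
  trees-sound (suc f) (suc zero) _ | inj₁ (here refl) = leaf , refl
  ... | inj₂ t∈nodes with ∈-map⁻ node t∈nodes
  ... | ts , ts∈ , refl = uncurry node-isSchroeder (forests₂-sound f n ts∈)

  forests-sound : ∀ f n {ts} → ts ∈ forests f n → IsForest n ts × 1 ≤ length ts
  forests-sound (suc f) n ts∈ with ∈-++⁻ (map [_] (trees (suc f) n)) ts∈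
  ... | inj₂ ts∈₂ = map₂ (ℕ.≤-trans (s≤s z≤n)) (forests₂-sound f n ts∈₂)
  ... | inj₁ ts∈singletons with ∈-map⁻ [_] ts∈singletons
  ... | t , t∈ , refl with trees-sound (suc f) n t∈
  ... | schroeder , leaves≡n =
    (schroeder ∷ [] , trans (ℕ.+-identityʳ (leaves t)) leaves≡n) , s≤s z≤n

  forests₂-sound : ∀ f n {ts} → ts ∈ forests₂ f n → IsForest n ts × 2 ≤ length ts
  forests₂-sound f n ts∈ with find (∈-concatMap⁻ (consForests f) ts∈)
  ... | (i , m) , im∈ , ts∈cons with consForests-sound f i m ts∈cons | ∈-compositions₂⁻ {n} im∈
  ... | forest , 2≤len , _ | _ , _ , refl = forest , 2≤len

  consForests-sound : ∀ f i m {ts} → ts ∈ consForests f (i , m) →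
    IsForest (i ℕ.+ m) ts × 2 ≤ length ts × headSplit ts ≡ (i , m)
  consForests-sound f i m ts∈ with ∈-cartesianProductWith⁻ _∷_ (trees f i) (forests f m) ts∈
  ... | t , r , t∈ , r∈ , refl with trees-sound f i t∈ | forests-sound f m r∈
  ... | t-schroeder , refl | (r-schroeder , refl) , 1≤len =
    (t-schroeder ∷ r-schroeder , refl) , s≤s 1≤len , refl

summandˡ-bound : ∀ {i m f} → 1 ≤ m → i ℕ.+ m ≤ suc f → i ≤ f
summandˡ-bound {i} 1≤m i+m≤1+f = ℕ.≤-pred (ℕ.≤-trans (ℕ.m<m+n i 1≤m) i+m≤1+f)

summandʳ-bound : ∀ {i m f} → 1 ≤ i → i ℕ.+ m ≤ suc f → m ≤ f
summandʳ-bound {i} {m} 1≤i i+m≤1+f = ℕ.≤-pred (ℕ.≤-trans (ℕ.m<n+m m 1≤i) i+m≤1+f)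

mutual
  trees-complete : ∀ f n {t} → n ≤ f → IsSchroeder t → leaves t ≡ n → t ∈ trees f n
  trees-complete zero n {t} n≤0 _ refl = ⊥-elim (ℕ.<⇒≱ (leaves-positive t) n≤0)
  trees-complete (suc f) .1 _ leaf refl = here refl
  trees-complete (suc f) n {node ts@(_ ∷ _)} n≤1+f (inner 2≤len schroeder) refl =
    ∈-++⁺ʳ (leafTrees n) (∈-map⁺ node (forests₂-complete f n n≤1+f (schroeder , refl) 2≤len))

  forests-complete : ∀ f n {ts} → n ≤ f → IsForest n ts → 1 ≤ length ts → ts ∈ forests f n
  forests-complete zero n {ts} n≤0 (_ , refl) 1≤len = ⊥-elim (ℕ.<⇒≱ (leavesL-positive ts 1≤len) n≤0)
  forests-complete (suc f) n {t ∷ []} n≤f (schroeder ∷ [] , refl) _ =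
    ∈-++⁺ˡ (∈-map⁺ [_] (trees-complete (suc f) n n≤f schroeder (sym (ℕ.+-identityʳ (leaves t)))))
  forests-complete (suc f) n {ts@(_ ∷ _ ∷ _)} n≤f forest _ =
    ∈-++⁺ʳ (map [_] (trees (suc f) n)) (forests₂-complete f n n≤f forest (s≤s (s≤s z≤n)))

  forests₂-complete : ∀ f n {ts} → n ≤ suc f → IsForest n ts → 2 ≤ length ts → ts ∈ forests₂ f n
  forests₂-complete f n {t ∷ r} n≤1+f (t-schroeder ∷ r-schroeder , refl) (s≤s 1≤len) =
    ∈-concatMap⁺ (consForests f) (lose im∈ (∈-cartesianProductWith⁺ _∷_ t∈ r∈))
    where
    1≤i = leaves-positive t
    1≤m = leavesL-positive r 1≤len
    im∈ = ∈-compositions₂⁺ 1≤i 1≤m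
    t∈ = trees-complete f (leaves t) (summandˡ-bound 1≤m n≤1+f) t-schroeder refl
    r∈ = forests-complete f (leavesL r) (summandʳ-bound 1≤i n≤1+f) (r-schroeder , refl) 1≤len

leafTrees-unique : ∀ n → Unique (leafTrees n)
leafTrees-unique zero = []
leafTrees-unique (suc zero) = [] ∷ []
leafTrees-unique (suc (suc n)) = []

∈-leafTrees⁻ : ∀ n {t} → t ∈ leafTrees n → t ≡ node []
∈-leafTrees⁻ (suc zero) (here t≡leaf) = t≡leaf

node-injective : ∀ {ts us} → node ts ≡ node us → ts ≡ us
node-injective refl = refl

[-]-injective : ∀ {t u : Tree} → [ t ] ≡ [ u ] → t ≡ u
[-]-injective refl = refl

mutual
  trees-unique : ∀ f n → Unique (trees f n)
  trees-unique zero n = []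
  trees-unique (suc f) n =
    Unique.++⁺ (leafTrees-unique n) (Unique.map⁺ node-injective (forests₂-unique f n)) leaf∉nodes
    where
    leaf∉nodes : ∀ {t} → t ∈ leafTrees n × t ∈ map node (forests₂ f n) → ⊥
    leaf∉nodes (t∈leaf , t∈nodes) with ∈-leafTrees⁻ n t∈leaf | ∈-map⁻ node t∈nodes
    ... | refl | [] , []∈ , refl with forests₂-sound f n []∈
    ... | _ , ()

  forests-unique : ∀ f n → Unique (forests f n)
  forests-unique zero n = []
  forests-unique (suc f) n =
    Unique.++⁺ (Unique.map⁺ [-]-injective (trees-unique (suc f) n)) (forests₂-unique f n)
      singleton∉forests₂
    where
    singleton∉forests₂ : ∀ {ts} → ts ∈ map [_] (trees (suc f) n) × ts ∈ forests₂ f n → ⊥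
    singleton∉forests₂ (ts∈ , ts∈₂) with ∈-map⁻ [_] ts∈
    ... | _ , _ , refl with forests₂-sound f n ts∈₂
    ... | _ , s≤s ()

  forests₂-unique : ∀ f n → Unique (forests₂ f n)
  forests₂-unique f n =
    unique-concatMap headSplit (consForests f)
      (λ (i , m) ts∈ → proj₂ (proj₂ (consForests-sound f i m ts∈)))
      (consForests-unique f) (compositions₂-unique n)

  consForests-unique : ∀ f im → Unique (consForests f im)
  consForests-unique f (i , m) =
    Unique.cartesianProductWith⁺ _∷_ ∷-injective (trees-unique f i) (forests-unique f m)

sign : Tree → ℤ
sign t = signPow (internals t)

forestSign : List Tree → ℤ
forestSign ts = signPow (internalsL ts)

δ₁ : ℕ → ℤ
δ₁ (suc zero) = 1ℤ
δ₁ _ = 0ℤ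

signPow-+ : ∀ a b → signPow (a ℕ.+ b) ≡ signPow a * signPow b
signPow-+ zero b = sym (ℤ.*-identityˡ (signPow b))
signPow-+ (suc a) b = trans (cong -_ (signPow-+ a b)) (ℤ.neg-distribˡ-* (signPow a) (signPow b))

forestSign-∷ : ∀ t ts → forestSign (t ∷ ts) ≡ sign t * forestSign ts
forestSign-∷ t ts = signPow-+ (internals t) (internalsL ts)

forestSign-[_] : ∀ t → forestSign [ t ] ≡ sign t
forestSign-[ t ] = cong signPow (ℕ.+-identityʳ (internals t))

sumBy-δ₁-compositions₂ : ∀ (h : ℕ → ℤ) k →
  sumBy (λ p → h (proj₁ p) * δ₁ (proj₂ p)) (compositions₂ (suc (suc k))) ≡ h (suc k)
sumBy-δ₁-compositions₂ h k = begin
  h (suc k) * 1ℤ + sumBy (λ p → h (proj₁ p) * δ₁ (proj₂ p)) (map (map₂ suc) (compositions₂ (suc k)))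
    ≡⟨ cong₂ _+_ (ℤ.*-identityʳ (h (suc k)))
                 (trans (sumBy-map _ (map₂ suc) (compositions₂ (suc k))) (sumBy-zero _ m≥2)) ⟩
  h (suc k) + 0ℤ
    ≡⟨ ℤ.+-identityʳ (h (suc k)) ⟩
  h (suc k) ∎
  where
  open ≡-Reasoning
  m≥2 : ∀ {p} → p ∈ compositions₂ (suc k) → h (proj₁ p) * δ₁ (suc (proj₂ p)) ≡ 0ℤ
  m≥2 {i , m} p∈ with ∈-compositions₂⁻ p∈
  ... | _ , s≤s _ , _ = ℤ.*-zeroʳ (h i)

sumBy-sign-trees-suc : ∀ f n → sumBy sign (trees (suc f) n) ≡ δ₁ n - sumBy forestSign (forests₂ f n)
sumBy-sign-trees-suc f n = begin
  sumBy sign (leafTrees n ++ map node (forests₂ f n))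
    ≡⟨ sumBy-++ sign (leafTrees n) _ ⟩
  sumBy sign (leafTrees n) + sumBy sign (map node (forests₂ f n))
    ≡⟨ cong₂ _+_ (sumBy-sign-leafTrees n) (sumBy-map sign node (forests₂ f n)) ⟩
  δ₁ n + sumBy (sign ∘ node) (forests₂ f n)
    ≡⟨ cong (_+_ (δ₁ n)) (sumBy-cong (forests₂ f n) sign-node) ⟩
  δ₁ n + sumBy (-_ ∘ forestSign) (forests₂ f n)
    ≡⟨ cong (_+_ (δ₁ n)) (sumBy-neg forestSign (forests₂ f n)) ⟩
  δ₁ n - sumBy forestSign (forests₂ f n) ∎
  where
  open ≡-Reasoning
  sumBy-sign-leafTrees : ∀ n → sumBy sign (leafTrees n) ≡ δ₁ n
  sumBy-sign-leafTrees zero = refl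
  sumBy-sign-leafTrees (suc zero) = refl
  sumBy-sign-leafTrees (suc (suc n)) = refl
  sign-node : ∀ {ts} → ts ∈ forests₂ f n → sign (node ts) ≡ - forestSign ts
  sign-node {ts} ts∈ with forests₂-sound f n ts∈
  sign-node {_ ∷ _} ts∈ | _ = refl

sumBy-forestSign-forests-suc : ∀ f n → sumBy forestSign (forests (suc f) n) ≡ δ₁ n
sumBy-forestSign-forests-suc f n = begin
  sumBy forestSign (map [_] (trees (suc f) n) ++ forests₂ f n)
    ≡⟨ sumBy-++ forestSign (map [_] (trees (suc f) n)) _ ⟩
  sumBy forestSign (map [_] (trees (suc f) n)) + S₂
    ≡⟨ cong (_+ S₂) (sumBy-map forestSign [_] (trees (suc f) n)) ⟩
  sumBy (forestSign ∘ [_]) (trees (suc f) n) + S₂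
    ≡⟨ cong (_+ S₂) (sumBy-cong (trees (suc f) n) λ {t} _ → forestSign-[ t ]) ⟩
  sumBy sign (trees (suc f) n) + S₂
    ≡⟨ cong (_+ S₂) (sumBy-sign-trees-suc f n) ⟩
  δ₁ n - S₂ + S₂
    ≡⟨ cancel (δ₁ n) S₂ ⟩
  δ₁ n ∎
  where
  open ≡-Reasoning
  S₂ = sumBy forestSign (forests₂ f n)
  cancel : ∀ a b → a - b + b ≡ a
  cancel = solve-∀

sumBy-forestSign-forests₂ : ∀ f k →
  sumBy forestSign (forests₂ (suc f) (suc (suc k))) ≡ sumBy sign (trees (suc f) (suc k))
sumBy-forestSign-forests₂ f k = begin
  sumBy forestSign (concatMap (consForests (suc f)) (compositions₂ (suc (suc k))))
    ≡⟨ sumBy-concatMap forestSign (consForests (suc f)) (compositions₂ (suc (suc k))) ⟩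
  sumBy (sumBy forestSign ∘ consForests (suc f)) (compositions₂ (suc (suc k)))
    ≡⟨ sumBy-cong (compositions₂ (suc (suc k))) (λ {p} _ → sumBy-consForests p) ⟩
  sumBy (λ p → sumBy sign (trees (suc f) (proj₁ p)) * δ₁ (proj₂ p)) (compositions₂ (suc (suc k)))
    ≡⟨ sumBy-δ₁-compositions₂ (sumBy sign ∘ trees (suc f)) k ⟩
  sumBy sign (trees (suc f) (suc k)) ∎
  where
  open ≡-Reasoning
  sumBy-consForests : ∀ p →
    sumBy forestSign (consForests (suc f) p) ≡ sumBy sign (trees (suc f) (proj₁ p)) * δ₁ (proj₂ p)
  sumBy-consForests (i , m) =
    trans (sumBy-cartesianProductWith _∷_ forestSign sign forestSign forestSign-∷
             (trees (suc f) i) (forests (suc f) m))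
          (cong (sumBy sign (trees (suc f) i) *_) (sumBy-forestSign-forests-suc f m))

sumBy-sign-trees : ∀ f n → 1 ≤ n → n ≤ f → sumBy sign (trees f n) ≡ signPow (suc n)
sumBy-sign-trees (suc f) (suc zero) _ _ = refl
sumBy-sign-trees (suc zero) (suc (suc k)) _ (s≤s ())
sumBy-sign-trees (suc (suc f)) (suc (suc k)) _ (s≤s k+1≤f+1) = begin
  sumBy sign (trees (suc (suc f)) (suc (suc k)))
    ≡⟨ sumBy-sign-trees-suc (suc f) (suc (suc k)) ⟩
  0ℤ - sumBy forestSign (forests₂ (suc f) (suc (suc k)))
    ≡⟨ ℤ.+-identityˡ _ ⟩
  - sumBy forestSign (forests₂ (suc f) (suc (suc k)))
    ≡⟨ cong -_ (sumBy-forestSign-forests₂ f k) ⟩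
  - sumBy sign (trees (suc f) (suc k))
    ≡⟨ cong -_ (sumBy-sign-trees (suc f) (suc k) (s≤s z≤n) k+1≤f+1) ⟩
  signPow (suc (suc (suc k))) ∎
  where open ≡-Reasoning

isOdd-suc-suc : ∀ k → isOdd (suc (suc k)) ≡ isOdd k
isOdd-suc-suc k = cong (ℕ._≡ᵇ 1) (trans (cong (_% 2) (ℕ.+-comm 2 k)) ([m+n]%n≡m%n k 2))

signPow-isOdd : ∀ k → signPow k ≡ (if isOdd k then -1ℤ else 1ℤ)
signPow-isOdd zero = refl
signPow-isOdd (suc zero) = refl
signPow-isOdd (suc (suc k)) =
  trans (ℤ.neg-involutive (signPow k))
    (trans (signPow-isOdd k) (cong (if_then -1ℤ else 1ℤ) (sym (isOdd-suc-suc k))))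

countOdd+sumBy-sign≡countEven : ∀ L → + countOdd L + sumBy sign L ≡ + countEven L
countOdd+sumBy-sign≡countEven [] = refl
countOdd+sumBy-sign≡countEven (t ∷ ts) rewrite signPow-isOdd (internals t) with isOdd (internals t)
... | true = trans (odd (+ countOdd ts) (sumBy sign ts)) (countOdd+sumBy-sign≡countEven ts)
  where
  odd : ∀ a s → (1ℤ + a) + (-1ℤ + s) ≡ a + s
  odd = solve-∀
... | false =
  trans (even (+ countOdd ts) (sumBy sign ts)) (cong (_+_ 1ℤ) (countOdd+sumBy-sign≡countEven ts))
  where
  even : ∀ a s → a + (1ℤ + s) ≡ 1ℤ + (a + s)
  even = solve-∀

schroederTrees : ℕ → List Tree
schroederTrees n = trees n n

schroederTrees-isEnumeration : ∀ n → IsEnumeration n (schroederTrees n)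
schroederTrees-isEnumeration n =
  trees-unique n n ,
  (λ t → trees-sound n n) ,
  (λ t → trees-complete n n ℕ.≤-refl)

enumerations-↭ : ∀ {n L L′} → IsEnumeration n L → IsEnumeration n L′ → L ↭ L′
enumerations-↭ (L-unique , L-sound , L-complete) (L′-unique , L′-sound , L′-complete) =
  unique-same-members⇒↭ L-unique L′-unique
    (λ {t} t∈L → uncurry (L′-complete t) (L-sound t t∈L))
    (λ {t} t∈L′ → uncurry (L-complete t) (L′-sound t t∈L′))

sumBy-sign-enumeration : ∀ {n L} → 1 ≤ n → IsEnumeration n L → sumBy sign L ≡ signPow (suc n)
sumBy-sign-enumeration {n} 1≤n enumeration =
  trans (sumBy-↭ sign (enumerations-↭ enumeration (schroederTrees-isEnumeration n)))
        (sumBy-sign-trees n n 1≤n ℕ.≤-refl)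

proposition6 : (n : ℕ) → n ≥ 1 →
    Σ (List Tree) (IsEnumeration n)
    × ((L : List Tree) → IsEnumeration n L →
         + countOdd L ≡ + countEven L + signPow n)
proposition6 n n≥1 = (schroederTrees n , schroederTrees-isEnumeration n) , parity
  where
  parity : (L : List Tree) → IsEnumeration n L → + countOdd L ≡ + countEven L + signPow n
  parity L enumeration = begin
    + countOdd L
      ≡⟨ move (+ countOdd L) (signPow n) ⟩
    + countOdd L + - signPow n + signPow n
      ≡⟨ cong (λ s → + countOdd L + s + signPow n) (sym (sumBy-sign-enumeration n≥1 enumeration)) ⟩
    + countOdd L + sumBy sign L + signPow n
      ≡⟨ cong (_+ signPow n) (countOdd+sumBy-sign≡countEven L) ⟩
    + countEven L + signPow n ∎
    where
    open ≡-Reasoning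
    move : ∀ a s → a ≡ a + - s + s
    move = solve-∀
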